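{- Let $M_1=(S_1,r_1)$ and $M_2=(S_2,r_2)$ be matroids (given by their rank functions), let $B_1$ be a basis of $M_1$ and $B_2$ a basis of $M_2$, and set $S=S_1\times S_2$. Then there is a matroid $M=(S,r)$ which is a coupling of $M_1$ and $M_2$ and satisfies $r(Y_1\times Y_2)=r_1(Y_1)\cdot r_2(Y_2)$ for all $Y_1\subseteq S_1$, $Y_2\subseteq S_2$ with $Y_1\subseteq B_1$ or $Y_2\subseteq B_2$.
   Context: A matroid $M=(S,r)$ on a finite set $S$ is a matroid with rank function $r$. A matroid $M=(S_1\times S_2,r)$ is a coupling of $M_1=(S_1,r_1)$ and $M_2=(S_2,r_2)$ if $r(X_1\times S_2)=r_1(X_1)\cdot r_2(S_2)$ for all $X_1\subseteq S_1$ and $r(S_1\times X_2)=r_1(S_1)\cdot r_2(X_2)$ for all $X_2\subseteq S_2$. -}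

module Defs where

open import Data.Nat using (ℕ; _≤_; _+_; _*_)
open import Data.Bool using (Bool; true; false; _∧_; _∨_; T)
open import Data.Fin using (Fin)
open import Data.List using (List; filter; length; allFin; cartesianProduct)
open import Data.Product using (_×_; _,_)
open import Relation.Binary.PropositionalEquality using (_≡_)
open import Data.Bool using (_≟_)

SubsetOf : Set → Set
SubsetOf A = A → Bool

_⊆_ : {A : Set} → SubsetOf A → SubsetOf A → Set
_⊆_ {A} X Y = (a : A) → T (X a) → T (Y a)

_∪_ : {A : Set} → SubsetOf A → SubsetOf A → SubsetOf A
(X ∪ Y) a = X a ∨ Y a

_∩_ : {A : Set} → SubsetOf A → SubsetOf A → SubsetOf A
(X ∩ Y) a = X a ∧ Y a

full : {A : Set} → SubsetOf A
full _ = true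

-- A finite ground set: a type together with a list enumerating each element exactly once.
record FiniteSet : Set₁ where
  field
    Carrier : Set
    elems   : List Carrier

open FiniteSet public

∣_∣ₛ : {E : FiniteSet} → SubsetOf (Carrier E) → ℕ
∣_∣ₛ {E} X = length (filter (λ a → X a ≟ true) (elems E))

FinSet : ℕ → FiniteSet
FinSet n = record { Carrier = Fin n ; elems = allFin n }

_⊗_ : FiniteSet → FiniteSet → FiniteSet
E ⊗ F = record { Carrier = Carrier E × Carrier F
               ; elems = cartesianProduct (elems E) (elems F) }

record IsMatroidRank (E : FiniteSet) (r : SubsetOf (Carrier E) → ℕ) : Set where
  field
    bounded    : ∀ X → r X ≤ ∣_∣ₛ {E} X
    monotone   : ∀ X Y → X ⊆ Y → r X ≤ r Y
    submodular : ∀ X Y → r (X ∪ Y) + r (X ∩ Y) ≤ r X + r Y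

record Matroid (n : ℕ) : Set where
  field
    rank   : SubsetOf (Fin n) → ℕ
    isRank : IsMatroidRank (FinSet n) rank

open Matroid public

IsBasis : {n : ℕ} → Matroid n → SubsetOf (Fin n) → Set
IsBasis {n} M B = (rank M B ≡ ∣_∣ₛ {FinSet n} B) × (rank M B ≡ rank M full)

_⊠_ : {A B : Set} → SubsetOf A → SubsetOf B → SubsetOf (A × B)
(X ⊠ Y) (a , b) = X a ∧ Y b

IsCoupling : {n₁ n₂ : ℕ} → Matroid n₁ → Matroid n₂ →
             (SubsetOf (Fin n₁ × Fin n₂) → ℕ) → Set
IsCoupling {n₁} {n₂} M₁ M₂ r =
  IsMatroidRank (FinSet n₁ ⊗ FinSet n₂) r
  × (∀ X₁ → r (X₁ ⊠ full) ≡ rank M₁ X₁ * rank M₂ full)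
  × (∀ X₂ → r (full ⊠ X₂) ≡ rank M₁ full * rank M₂ X₂)

-- Let g be the rank of the direct sum of copies of M₁ on the columns S₁ × {c}, c ∈ B₂ (all other
-- points being loops), and h the rank of the direct sum of copies of M₂ on the rows {a} × S₂, a ∈ B₁.
-- Both are matroid ranks on S₁ × S₂ which are free on D = B₁ × B₂, and we glue them along D:
--   r(Z) = min over W of  g(Z ∪ (W ∩ D)) + h(Z ∪ (W ∩ D)) − |W ∩ D|.
-- The quantity being minimised is jointly submodular in (Z, W), so partial minimisation keeps r
-- submodular, and r is a matroid rank with  max(g, h) ≤ r ≤ g + h − |· ∩ D|  (take W = Z).
-- Thus r = h wherever g(Z) = |Z ∩ D| and r = g wherever h(Z) = |Z ∩ D|.  On a rectangle,
-- g(Y₁ × Y₂) = r₁(Y₁)·|Y₂ ∩ B₂| and h(Y₁ × Y₂) = r₂(Y₂)·|Y₁ ∩ B₁|, so r(Y₁ × Y₂) = r₁(Y₁)·r₂(Y₂)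
-- as soon as r₁(Y₁) = |Y₁ ∩ B₁| or r₂(Y₂) = |Y₂ ∩ B₂|, i.e. for Y₁ ⊆ B₁, Y₁ = S₁, Y₂ ⊆ B₂ or Y₂ = S₂.

module Submission where

open import Defs
open import Data.Nat using (ℕ; zero; suc; _+_; _*_; _∸_; _≤_; z≤n)
open import Data.Fin using (Fin; zero; suc)
open import Data.Product using (Σ; _×_; _,_; proj₁; proj₂; swap)
open import Data.Sum using (_⊎_; inj₁; inj₂)
open import Relation.Binary.PropositionalEquality
  using (_≡_; refl; sym; trans; cong; cong₂; subst; _≗_; module ≡-Reasoning)

open import Data.Nat.Properties
  using ( +-*-semiring; +-commutativeSemigroup; ≤-refl; ≤-reflexive; ≤-trans; ≤-antisym; ≤-total
        ; +-mono-≤; +-monoʳ-≤; +-monoˡ-≤; +-cancelʳ-≤; m≤m+n; m≤n+m; +-identityʳ; *-identityʳ; *-zeroʳ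
        ; *-comm; ∸-mono; ∸-monoˡ-≤; +-∸-assoc; +-∸-comm; ∸-+-assoc; m+n∸n≡m; m+n∸m≡n
        ; m≤n+o⇒m∸n≤o; module ≤-Reasoning)
open import Algebra.Properties.CommutativeSemigroup +-commutativeSemigroup
  using () renaming (interchange to +-interchange)
open import Algebra.Properties.Semiring.Sum +-*-semiring
  using (sum; sum-syntax; sum-cong-≗; sum-replicate-zero; ∑-distrib-+; ∑-comm; *-distribˡ-sum; *-distribʳ-sum)
open import Data.Bool using (Bool; true; false; _∧_; _∨_; not; T; if_then_else_; _≟_)
open import Data.Bool.Properties using (∧-comm; ∧-identityʳ; ∧-zeroʳ; ∨-abs-∧; T-∧; T-∨; T-≡)
open import Data.Bool.Solver using (module ∨-∧-Solver)
open import Data.Empty using (⊥-elim)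
open import Data.Fin.Properties using (*↔×)
open import Data.List using (_++_; map; filter; length; tabulate; allFin; cartesianProduct)
open import Data.List.Properties using (length-++; filter-++; map-tabulate)
import Data.Product as Product
import Data.Sum as Sum
open import Data.Unit using (tt)
open import Data.Vec.Functional using (Vector; []; _∷_; head; tail)
open import Function using (id; _∘_; _↔_; Inverse; Equivalence)

private
  variable
    A B : Set

∅ : SubsetOf A
∅ _ = false

≗⇒⊆ : {X Y : SubsetOf A} → X ≗ Y → X ⊆ Y
≗⇒⊆ X≗Y a = subst T (X≗Y a)

⊆-∪ˡ : {X Y : SubsetOf A} → X ⊆ (X ∪ Y)
⊆-∪ˡ {X = X} {Y} a t = Equivalence.from (T-∨ {X a} {Y a}) (inj₁ t)

⊆-∪ʳ : {X Y : SubsetOf A} → Y ⊆ (X ∪ Y)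
⊆-∪ʳ {X = X} {Y} a t = Equivalence.from (T-∨ {X a} {Y a}) (inj₂ t)

∩-⊆ˡ : {X Y : SubsetOf A} → (X ∩ Y) ⊆ X
∩-⊆ˡ {X = X} {Y} a t = proj₁ (Equivalence.to (T-∧ {X a} {Y a}) t)

∩-⊆ʳ : {X Y : SubsetOf A} → (X ∩ Y) ⊆ Y
∩-⊆ʳ {X = X} {Y} a t = proj₂ (Equivalence.to (T-∧ {X a} {Y a}) t)

⊆-∩ : {U X Y : SubsetOf A} → U ⊆ X → U ⊆ Y → U ⊆ (X ∩ Y)
⊆-∩ {X = X} {Y} U⊆X U⊆Y a t = Equivalence.from (T-∧ {X a} {Y a}) (U⊆X a t , U⊆Y a t)

∪-mono : {X X′ Y Y′ : SubsetOf A} → X ⊆ X′ → Y ⊆ Y′ → (X ∪ Y) ⊆ (X′ ∪ Y′)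
∪-mono {X = X} {X′} {Y} {Y′} X⊆X′ Y⊆Y′ a t =
  Equivalence.from (T-∨ {X′ a} {Y′ a})
    (Sum.map (X⊆X′ a) (Y⊆Y′ a) (Equivalence.to (T-∨ {X a} {Y a}) t))

∩-mono : {X X′ Y Y′ : SubsetOf A} → X ⊆ X′ → Y ⊆ Y′ → (X ∩ Y) ⊆ (X′ ∩ Y′)
∩-mono {X = X} {X′} {Y} {Y′} X⊆X′ Y⊆Y′ a t =
  Equivalence.from (T-∧ {X′ a} {Y′ a})
    (Product.map (X⊆X′ a) (Y⊆Y′ a) (Equivalence.to (T-∧ {X a} {Y a}) t))

⊆⇒∩≗ : {X Y : SubsetOf A} → X ⊆ Y → (X ∩ Y) ≗ X
⊆⇒∩≗ {X = X} {Y} X⊆Y a with X a | X⊆Y a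
... | true  | Ya = Equivalence.to T-≡ (Ya tt)
... | false | _  = refl

column : SubsetOf (A × B) → B → SubsetOf A
column X c a = X (a , c)

transpose : SubsetOf (A × B) → SubsetOf (B × A)
transpose X = X ∘ swap

𝟙 : Bool → ℕ
𝟙 true  = 1
𝟙 false = 0

count : {n : ℕ} → SubsetOf (Fin n) → ℕ
count {n} X = ∑[ i < n ] 𝟙 (X i)

count₂ : {n₁ n₂ : ℕ} → SubsetOf (Fin n₁ × Fin n₂) → ℕ
count₂ {n₁} {n₂} X = ∑[ a < n₁ ] ∑[ c < n₂ ] 𝟙 (X (a , c))

∑-mono-≤ : {n : ℕ} {f g : Fin n → ℕ} → (∀ i → f i ≤ g i) → sum f ≤ sum g
∑-mono-≤ {zero}  f≤g = z≤n
∑-mono-≤ {suc n} f≤g = +-mono-≤ (f≤g zero) (∑-mono-≤ (f≤g ∘ suc))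

count-cong : {n : ℕ} {X Y : SubsetOf (Fin n)} → X ≗ Y → count X ≡ count Y
count-cong X≗Y = sum-cong-≗ (cong 𝟙 ∘ X≗Y)

count₂-cong : {n₁ n₂ : ℕ} {X Y : SubsetOf (Fin n₁ × Fin n₂)} → X ≗ Y → count₂ X ≡ count₂ Y
count₂-cong X≗Y = sum-cong-≗ (λ a → count-cong (λ c → X≗Y (a , c)))

𝟙-mono : {x y : Bool} → (T x → T y) → 𝟙 x ≤ 𝟙 y
𝟙-mono {false} _   = z≤n
𝟙-mono {true}  {true}  _   = ≤-refl
𝟙-mono {true}  {false} x⇒y = ⊥-elim (x⇒y tt)

count-mono : {n : ℕ} {X Y : SubsetOf (Fin n)} → X ⊆ Y → count X ≤ count Y
count-mono X⊆Y = ∑-mono-≤ (λ i → 𝟙-mono (X⊆Y i))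

count-∅ : {n : ℕ} → count {n} ∅ ≡ 0
count-∅ {n} = sum-replicate-zero n

count-∧ˡ : {n : ℕ} (b : Bool) (X : SubsetOf (Fin n)) → count (λ i → b ∧ X i) ≡ 𝟙 b * count X
count-∧ˡ true  X = sym (+-identityʳ (count X))
count-∧ˡ {n} false X = count-∅ {n}

count-∧ʳ : {n : ℕ} (b : Bool) (X : SubsetOf (Fin n)) → count (λ i → X i ∧ b) ≡ (if b then count X else 0)
count-∧ʳ true  X = count-cong (∧-identityʳ ∘ X)
count-∧ʳ {n} false X = trans (count-cong (∧-zeroʳ ∘ X)) (count-∅ {n})

count₂-⊠ : {n₁ n₂ : ℕ} (X : SubsetOf (Fin n₁)) (Y : SubsetOf (Fin n₂)) →
           count₂ (X ⊠ Y) ≡ count X * count Y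
count₂-⊠ X Y = trans (sum-cong-≗ (λ a → count-∧ˡ (X a) Y)) (sym (*-distribʳ-sum (count Y) (𝟙 ∘ X)))

count₂-⊠-∩ : {n₁ n₂ : ℕ} (Y₁ B₁ : SubsetOf (Fin n₁)) (Y₂ B₂ : SubsetOf (Fin n₂)) →
             count₂ ((Y₁ ⊠ Y₂) ∩ (B₁ ⊠ B₂)) ≡ count (Y₁ ∩ B₁) * count (Y₂ ∩ B₂)
count₂-⊠-∩ Y₁ B₁ Y₂ B₂ = trans (count₂-cong interchange) (count₂-⊠ (Y₁ ∩ B₁) (Y₂ ∩ B₂))
  where
  open ∨-∧-Solver
  interchange : ((Y₁ ⊠ Y₂) ∩ (B₁ ⊠ B₂)) ≗ ((Y₁ ∩ B₁) ⊠ (Y₂ ∩ B₂))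
  interchange (a , c) =
    solve 4 (λ y₁ y₂ b₁ b₂ → (y₁ :* y₂) :* (b₁ :* b₂) := (y₁ :* b₁) :* (y₂ :* b₂))
          refl (Y₁ a) (Y₂ c) (B₁ a) (B₂ c)

count₂-transpose : {n₁ n₂ : ℕ} (X : SubsetOf (Fin n₁ × Fin n₂)) → count₂ (transpose X) ≡ count₂ X
count₂-transpose {n₁} {n₂} X = ∑-comm {n₂} {n₁} (λ c a → 𝟙 (X (a , c)))

count₂-+ : {n₁ n₂ : ℕ} (X Y : SubsetOf (Fin n₁ × Fin n₂)) →
           count₂ X + count₂ Y ≡ ∑[ a < n₁ ] ∑[ c < n₂ ] (𝟙 (X (a , c)) + 𝟙 (Y (a , c)))
count₂-+ {n₁} {n₂} X Y =
  sym (trans (sum-cong-≗ (λ a → ∑-distrib-+ {n₂} (λ c → 𝟙 (X (a , c))) (λ c → 𝟙 (Y (a , c)))))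
             (∑-distrib-+ {n₁} (λ a → count (λ c → X (a , c))) (λ a → count (λ c → Y (a , c)))))

count₂-+-≤ : {n₁ n₂ : ℕ} {X Y U V : SubsetOf (Fin n₁ × Fin n₂)} →
             (∀ p → 𝟙 (X p) + 𝟙 (Y p) ≤ 𝟙 (U p) + 𝟙 (V p)) →
             count₂ X + count₂ Y ≤ count₂ U + count₂ V
count₂-+-≤ {X = X} {Y} {U} {V} le = begin
  count₂ X + count₂ Y  ≡⟨ count₂-+ X Y ⟩
  _                    ≤⟨ ∑-mono-≤ (λ a → ∑-mono-≤ (λ c → le (a , c))) ⟩
  _                    ≡⟨ count₂-+ U V ⟨
  count₂ U + count₂ V  ∎
  where open ≤-Reasoning

𝟙-∩-modular : (x y d : Bool) → 𝟙 ((x ∨ y) ∧ d) + 𝟙 ((x ∧ y) ∧ d) ≡ 𝟙 (x ∧ d) + 𝟙 (y ∧ d)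
𝟙-∩-modular true  y d = refl
𝟙-∩-modular false y d = +-identityʳ (𝟙 (y ∧ d))

count₂-∩-modular : {n₁ n₂ : ℕ} (X Y D : SubsetOf (Fin n₁ × Fin n₂)) →
                   count₂ ((X ∪ Y) ∩ D) + count₂ ((X ∩ Y) ∩ D) ≡ count₂ (X ∩ D) + count₂ (Y ∩ D)
count₂-∩-modular X Y D = begin
  count₂ ((X ∪ Y) ∩ D) + count₂ ((X ∩ Y) ∩ D)  ≡⟨ count₂-+ ((X ∪ Y) ∩ D) ((X ∩ Y) ∩ D) ⟩
  _  ≡⟨ sum-cong-≗ (λ a → sum-cong-≗ (λ c → 𝟙-∩-modular (X (a , c)) (Y (a , c)) (D (a , c)))) ⟩
  _  ≡⟨ count₂-+ (X ∩ D) (Y ∩ D) ⟨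
  count₂ (X ∩ D) + count₂ (Y ∩ D)  ∎
  where open ≡-Reasoning

count-tabulate : {n : ℕ} (f : Fin n → A) (X : SubsetOf A) →
                 length (filter (λ a → X a ≟ true) (tabulate f)) ≡ ∑[ i < n ] 𝟙 (X (f i))
count-tabulate {n = zero}  f X = refl
count-tabulate {n = suc n} f X with X (f zero)
... | true  = cong suc (count-tabulate (f ∘ suc) X)
... | false = count-tabulate (f ∘ suc) X

count-cartesianProduct : {n₁ : ℕ} (f : Fin n₁ → A) (n₂ : ℕ) (X : SubsetOf (A × Fin n₂)) →
  length (filter (λ p → X p ≟ true) (cartesianProduct (tabulate f) (allFin n₂)))
    ≡ ∑[ a < n₁ ] ∑[ c < n₂ ] 𝟙 (X (f a , c))
count-cartesianProduct {n₁ = zero}  f n₂ X = refl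
count-cartesianProduct {n₁ = suc n₁} f n₂ X = begin
  length (filter P? (row ++ rest))              ≡⟨ cong length (filter-++ P? row rest) ⟩
  length (filter P? row ++ filter P? rest)      ≡⟨ length-++ (filter P? row) ⟩
  length (filter P? row) + length (filter P? rest)
    ≡⟨ cong (λ xs → length (filter P? xs) + length (filter P? rest)) (map-tabulate id (f zero ,_)) ⟩
  length (filter P? (tabulate (f zero ,_))) + length (filter P? rest)
    ≡⟨ cong₂ _+_ (count-tabulate (f zero ,_) X) (count-cartesianProduct (f ∘ suc) n₂ X) ⟩
  _ ∎
  where
  open ≡-Reasoning
  P? = λ p → X p ≟ true
  row = map (f zero ,_) (allFin n₂)
  rest = cartesianProduct (tabulate (f ∘ suc)) (allFin n₂)

size≡count : {n : ℕ} (X : SubsetOf (Fin n)) → ∣_∣ₛ {FinSet n} X ≡ count X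
size≡count = count-tabulate id

size≡count₂ : {n₁ n₂ : ℕ} (X : SubsetOf (Fin n₁ × Fin n₂)) →
              ∣_∣ₛ {FinSet n₁ ⊗ FinSet n₂} X ≡ count₂ X
size≡count₂ {n₂ = n₂} = count-cartesianProduct id n₂

record IsMonotoneSubmodular {A : Set} (f : SubsetOf A → ℕ) : Set where
  field
    monotone   : ∀ X Y → X ⊆ Y → f X ≤ f Y
    submodular : ∀ X Y → f (X ∪ Y) + f (X ∩ Y) ≤ f X + f Y

  cong-≗ : {X Y : SubsetOf A} → X ≗ Y → f X ≡ f Y
  cong-≗ X≗Y = ≤-antisym (monotone _ _ (≗⇒⊆ X≗Y)) (monotone _ _ (≗⇒⊆ (sym ∘ X≗Y)))

  submodular-⊆ : {U V : SubsetOf A} (X Y : SubsetOf A) → U ⊆ (X ∪ Y) → V ⊆ (X ∩ Y) →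
                 f U + f V ≤ f X + f Y
  submodular-⊆ X Y U⊆X∪Y V⊆X∩Y =
    ≤-trans (+-mono-≤ (monotone _ _ U⊆X∪Y) (monotone _ _ V⊆X∩Y)) (submodular X Y)

preimage-isMonotoneSubmodular : {f : SubsetOf A → ℕ} (π : A → B) →
  IsMonotoneSubmodular f → IsMonotoneSubmodular (λ X → f (X ∘ π))
preimage-isMonotoneSubmodular π f-ms = record
  { monotone   = λ X Y X⊆Y → monotone (X ∘ π) (Y ∘ π) (X⊆Y ∘ π)
  ; submodular = λ X Y → submodular (X ∘ π) (Y ∘ π)
  }
  where open IsMonotoneSubmodular f-ms

if-isMonotoneSubmodular : {f : SubsetOf A → ℕ} (b : Bool) →
  IsMonotoneSubmodular f → IsMonotoneSubmodular (λ X → if b then f X else 0)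
if-isMonotoneSubmodular true  f-ms = f-ms
if-isMonotoneSubmodular false f-ms = record { monotone = λ _ _ _ → z≤n ; submodular = λ _ _ → z≤n }

+-isMonotoneSubmodular : {f g : SubsetOf A → ℕ} →
  IsMonotoneSubmodular f → IsMonotoneSubmodular g → IsMonotoneSubmodular (λ X → f X + g X)
+-isMonotoneSubmodular {f = f} {g} f-ms g-ms = record
  { monotone   = λ X Y X⊆Y → +-mono-≤ (F.monotone X Y X⊆Y) (G.monotone X Y X⊆Y)
  ; submodular = λ X Y → begin
      f (X ∪ Y) + g (X ∪ Y) + (f (X ∩ Y) + g (X ∩ Y))  ≡⟨ +-interchange (f (X ∪ Y)) _ _ _ ⟩
      f (X ∪ Y) + f (X ∩ Y) + (g (X ∪ Y) + g (X ∩ Y))  ≤⟨ +-mono-≤ (F.submodular X Y) (G.submodular X Y) ⟩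
      f X + f Y + (g X + g Y)                          ≡⟨ +-interchange (f X) _ _ _ ⟩
      f X + g X + (f Y + g Y)                          ∎
  }
  where
  module F = IsMonotoneSubmodular f-ms
  module G = IsMonotoneSubmodular g-ms
  open ≤-Reasoning

∑-isMonotoneSubmodular : {m : ℕ} {f : Fin m → SubsetOf A → ℕ} →
  (∀ c → IsMonotoneSubmodular (f c)) → IsMonotoneSubmodular (λ X → ∑[ c < m ] f c X)
∑-isMonotoneSubmodular {m = m} {f} f-ms = record
  { monotone   = λ X Y X⊆Y → ∑-mono-≤ (λ c → IsMonotoneSubmodular.monotone (f-ms c) X Y X⊆Y)
  ; submodular = λ X Y → begin
      ∑[ c < m ] f c (X ∪ Y) + ∑[ c < m ] f c (X ∩ Y)
        ≡⟨ ∑-distrib-+ (λ c → f c (X ∪ Y)) (λ c → f c (X ∩ Y)) ⟨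
      ∑[ c < m ] (f c (X ∪ Y) + f c (X ∩ Y))
        ≤⟨ ∑-mono-≤ (λ c → IsMonotoneSubmodular.submodular (f-ms c) X Y) ⟩
      ∑[ c < m ] (f c X + f c Y)
        ≡⟨ ∑-distrib-+ (λ c → f c X) (λ c → f c Y) ⟩
      ∑[ c < m ] f c X + ∑[ c < m ] f c Y  ∎
  }
  where open ≤-Reasoning

-- Minimisation over finitely many subsets

Argmin : (A → ℕ) → Set
Argmin {A} f = Σ A (λ x → ∀ y → f x ≤ f y)

argmin-Bool : (f : Bool → ℕ) → Argmin f
argmin-Bool f with ≤-total (f false) (f true)
... | inj₁ f₀≤f₁ = false , λ { false → ≤-refl ; true → f₀≤f₁ }
... | inj₂ f₁≤f₀ = true  , λ { false → f₁≤f₀ ; true → ≤-refl }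

argmin-Vector : {A : Set} → ((f : A → ℕ) → Argmin f) → (n : ℕ) (f : Vector A n → ℕ) →
                (∀ {xs ys} → xs ≗ ys → f xs ≡ f ys) → Argmin f
argmin-Vector argmin zero    f f-cong = [] , λ ys → ≤-reflexive (f-cong (λ ()))
argmin-Vector {A} argmin (suc n) f f-cong = x₀ ∷ proj₁ (best x₀) , minimal
  where
  best : ∀ x → Argmin (λ xs → f (x ∷ xs))
  best x = argmin-Vector argmin n (λ xs → f (x ∷ xs))
                         (λ xs≗ys → f-cong λ { zero → refl ; (suc i) → xs≗ys i })

  candidate : A → ℕ
  candidate x = f (x ∷ proj₁ (best x))

  x₀ = proj₁ (argmin candidate)

  minimal : ∀ ys → f (x₀ ∷ proj₁ (best x₀)) ≤ f ys
  minimal ys = begin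
    f (x₀ ∷ proj₁ (best x₀))              ≤⟨ proj₂ (argmin candidate) (head ys) ⟩
    f (head ys ∷ proj₁ (best (head ys)))  ≤⟨ proj₂ (best (head ys)) (tail ys) ⟩
    f (head ys ∷ tail ys)                 ≡⟨ f-cong (λ { zero → refl ; (suc i) → refl }) ⟩
    f ys                                  ∎
    where open ≤-Reasoning

argmin-Subset : {n : ℕ} → Fin n ↔ A → (f : SubsetOf A → ℕ) →
                (∀ {X Y} → X ≗ Y → f X ≡ f Y) → Argmin f
argmin-Subset {n = n} Fin↔A f f-cong = V₀ ∘ from , λ Y →
  ≤-trans (V₀-minimal (Y ∘ to)) (≤-reflexive (f-cong (cong Y ∘ strictlyInverseˡ)))
  where
  open Inverse Fin↔A using (to; from; strictlyInverseˡ)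
  minimiser = argmin-Vector argmin-Bool n (f ∘ (_∘ from)) (f-cong ∘ (_∘ from))
  V₀ = proj₁ minimiser
  V₀-minimal = proj₂ minimiser

-- Matroid rank functions and direct sums of copies of a matroid

module _ {n : ℕ} (M : Matroid n) where
  open IsMatroidRank (isRank M)

  rank-isMonotoneSubmodular : IsMonotoneSubmodular (rank M)
  rank-isMonotoneSubmodular = record { monotone = monotone ; submodular = submodular }

  rank-cong : {X Y : SubsetOf (Fin n)} → X ≗ Y → rank M X ≡ rank M Y
  rank-cong = IsMonotoneSubmodular.cong-≗ rank-isMonotoneSubmodular

  rank-≤-count : ∀ X → rank M X ≤ count X
  rank-≤-count X = ≤-trans (bounded X) (≤-reflexive (size≡count X))

  rank-∅ : rank M ∅ ≡ 0
  rank-∅ = ≤-antisym (≤-trans (rank-≤-count ∅) (≤-reflexive (count-∅ {n}))) z≤n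

  rank-⊆-independent : {I Y : SubsetOf (Fin n)} → rank M I ≡ count I → Y ⊆ I → rank M Y ≡ count Y
  rank-⊆-independent {I} {Y} I-indep Y⊆I =
    ≤-antisym (rank-≤-count Y) (+-cancelʳ-≤ (count R) (count Y) (rank M Y) (begin
      count Y + count R                ≡⟨ count-split ⟩
      count I                          ≡⟨ I-indep ⟨
      rank M I                         ≤⟨ monotone I (Y ∪ R) I⊆Y∪R ⟩
      rank M (Y ∪ R)                   ≤⟨ m≤m+n (rank M (Y ∪ R)) (rank M (Y ∩ R)) ⟩
      rank M (Y ∪ R) + rank M (Y ∩ R)  ≤⟨ submodular Y R ⟩
      rank M Y + rank M R              ≤⟨ +-monoʳ-≤ (rank M Y) (rank-≤-count R) ⟩
      rank M Y + count R               ∎))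
    where
    open ≤-Reasoning
    R : SubsetOf (Fin n)
    R a = I a ∧ not (Y a)

    split : ∀ y i → (T y → T i) → 𝟙 y + 𝟙 (i ∧ not y) ≡ 𝟙 i
    split true  true  _   = refl
    split true  false y⇒i = ⊥-elim (y⇒i tt)
    split false i     _   = cong 𝟙 (∧-identityʳ i)

    count-split : count Y + count R ≡ count I
    count-split = trans (sym (∑-distrib-+ (𝟙 ∘ Y) (𝟙 ∘ R)))
                        (sum-cong-≗ (λ a → split (Y a) (I a) (Y⊆I a)))

    I⊆Y∪R : I ⊆ (Y ∪ R)
    I⊆Y∪R a with Y a
    ... | true  = λ _ → tt
    ... | false = subst T (sym (∧-identityʳ (I a)))

  basis-independent : {B : SubsetOf (Fin n)} → IsBasis M B → rank M B ≡ count B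
  basis-independent {B} (B-indep , _) = trans B-indep (size≡count {n} B)

  rank-⊆-basis : {B Y : SubsetOf (Fin n)} → IsBasis M B → Y ⊆ B → rank M Y ≡ count (Y ∩ B)
  rank-⊆-basis B-basis Y⊆B =
    trans (rank-⊆-independent (basis-independent B-basis) Y⊆B) (count-cong (sym ∘ ⊆⇒∩≗ Y⊆B))

  rank-full : {B : SubsetOf (Fin n)} → IsBasis M B → rank M full ≡ count B
  rank-full B-basis = trans (sym (proj₂ B-basis)) (basis-independent B-basis)

module _ {n : ℕ} (M : Matroid n) {m : ℕ} (C : SubsetOf (Fin m)) where

  -- The direct sum of copies of M on the columns indexed by C; the other columns consist of loops.
  columnRank : SubsetOf (Fin n × Fin m) → ℕ
  columnRank X = ∑[ c < m ] (if C c then rank M (column X c) else 0)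

  columnRank-isMonotoneSubmodular : IsMonotoneSubmodular columnRank
  columnRank-isMonotoneSubmodular = ∑-isMonotoneSubmodular (λ c →
    if-isMonotoneSubmodular (C c) (preimage-isMonotoneSubmodular (_, c) (rank-isMonotoneSubmodular M)))

  columnRank-≤-count : ∀ X → columnRank X ≤ count₂ (X ∩ (full ⊠ C))
  columnRank-≤-count X = begin
    columnRank X
      ≤⟨ ∑-mono-≤ (λ c → if-mono (C c) (rank-≤-count M (column X c))) ⟩
    ∑[ c < m ] (if C c then count (column X c) else 0)
      ≡⟨ sum-cong-≗ (λ c → count-∧ʳ (C c) (column X c)) ⟨
    ∑[ c < m ] ∑[ a < n ] 𝟙 (X (a , c) ∧ C c)
      ≡⟨ ∑-comm (λ c a → 𝟙 (X (a , c) ∧ C c)) ⟩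
    count₂ (X ∩ (full ⊠ C))  ∎
    where
    open ≤-Reasoning
    if-mono : ∀ b {x y} → x ≤ y → (if b then x else 0) ≤ (if b then y else 0)
    if-mono true  x≤y = x≤y
    if-mono false x≤y = z≤n

  columnRank-⊠ : ∀ Y Y′ → columnRank (Y ⊠ Y′) ≡ rank M Y * count (Y′ ∩ C)
  columnRank-⊠ Y Y′ = trans (sum-cong-≗ (λ c → column-rank (Y′ c) (C c)))
                            (sym (*-distribˡ-sum (rank M Y) (λ c → 𝟙 (Y′ c ∧ C c))))
    where
    column-rank : ∀ y b → (if b then rank M (λ a → Y a ∧ y) else 0) ≡ rank M Y * 𝟙 (y ∧ b)
    column-rank true  true  = trans (rank-cong M (∧-identityʳ ∘ Y)) (sym (*-identityʳ (rank M Y)))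
    column-rank false true  = trans (trans (rank-cong M (∧-zeroʳ ∘ Y)) (rank-∅ M)) (sym (*-zeroʳ (rank M Y)))
    column-rank true  false = sym (*-zeroʳ (rank M Y))
    column-rank false false = sym (*-zeroʳ (rank M Y))

  count₂-≤-columnRank : {B : SubsetOf (Fin n)} → IsBasis M B →
                        ∀ X → X ⊆ (B ⊠ C) → count₂ X ≤ columnRank X
  count₂-≤-columnRank {B} B-basis X X⊆B⊠C = begin
    count₂ X                       ≡⟨ ∑-comm (λ a c → 𝟙 (X (a , c))) ⟩
    ∑[ c < m ] count (column X c)  ≤⟨ ∑-mono-≤ (λ c → column-free (C c) (column X c) (λ a → X⊆B⊠C (a , c))) ⟩
    columnRank X                   ∎
    where
    open ≤-Reasoning
    column-free : ∀ b Y → (∀ a → T (Y a) → T (B a ∧ b)) → count Y ≤ (if b then rank M Y else 0)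
    column-free true  Y Y⊆B = ≤-reflexive (sym (rank-⊆-independent M (basis-independent M B-basis)
                                                  (λ a → subst T (∧-identityʳ (B a)) ∘ Y⊆B a)))
    column-free false Y Y⊆∅ = ≤-trans (count-mono (λ a → subst T (∧-zeroʳ (B a)) ∘ Y⊆∅ a))
                                      (≤-reflexive (count-∅ {n}))

-- Gluing two rank functions along a set on which both are free

+-∸-interchange : {a b x y : ℕ} → x ≤ a → y ≤ b → (a ∸ x) + (b ∸ y) ≡ (a + b) ∸ (x + y)
+-∸-interchange {a} {b} {x} {y} x≤a y≤b = begin
  (a ∸ x) + (b ∸ y)  ≡⟨ +-∸-assoc (a ∸ x) y≤b ⟨
  (a ∸ x) + b ∸ y    ≡⟨ cong (_∸ y) (+-∸-comm b x≤a) ⟨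
  (a + b) ∸ x ∸ y    ≡⟨ ∸-+-assoc (a + b) x y ⟩
  (a + b) ∸ (x + y)  ∎
  where open ≡-Reasoning

module Amalgam {n₁ n₂ : ℕ} {g h : SubsetOf (Fin n₁ × Fin n₂) → ℕ}
  (g-isMS : IsMonotoneSubmodular g) (h-isMS : IsMonotoneSubmodular h)
  (D : SubsetOf (Fin n₁ × Fin n₂))
  (count₂-≤-g : ∀ W → W ⊆ D → count₂ W ≤ g W)
  (count₂-≤-h : ∀ W → W ⊆ D → count₂ W ≤ h W) where

  private
    P = Fin n₁ × Fin n₂
    module G = IsMonotoneSubmodular g-isMS
    module H = IsMonotoneSubmodular h-isMS

  ψ : SubsetOf P → ℕ
  ψ X = g X + h X

  ψ-isMonotoneSubmodular : IsMonotoneSubmodular ψ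
  ψ-isMonotoneSubmodular = +-isMonotoneSubmodular g-isMS h-isMS

  private module Ψ = IsMonotoneSubmodular ψ-isMonotoneSubmodular

  glue : SubsetOf P → SubsetOf P → SubsetOf P
  glue Z W = Z ∪ (W ∩ D)

  glue-mono : {Z Z′ W W′ : SubsetOf P} → Z ⊆ Z′ → W ⊆ W′ → glue Z W ⊆ glue Z′ W′
  glue-mono Z⊆Z′ W⊆W′ = ∪-mono Z⊆Z′ (∩-mono W⊆W′ (λ _ t → t))

  glue-∪ : (Z Z′ W W′ : SubsetOf P) → glue (Z ∪ Z′) (W ∪ W′) ⊆ (glue Z W ∪ glue Z′ W′)
  glue-∪ Z Z′ W W′ = ≗⇒⊆ λ p →
    solve 5 (λ z z′ w w′ d → (z :+ z′) :+ ((w :+ w′) :* d) := (z :+ w :* d) :+ (z′ :+ w′ :* d))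
            refl (Z p) (Z′ p) (W p) (W′ p) (D p)
    where open ∨-∧-Solver

  glue-∩ : (Z Z′ W W′ : SubsetOf P) → glue (Z ∩ Z′) (W ∩ W′) ⊆ (glue Z W ∩ glue Z′ W′)
  glue-∩ Z Z′ W W′ = ⊆-∩ (glue-mono (∩-⊆ˡ {X = Z} {Z′}) (∩-⊆ˡ {X = W} {W′}))
                          (glue-mono (∩-⊆ʳ {X = Z} {Z′}) (∩-⊆ʳ {X = W} {W′}))

  count₂-∩-≤-h : ∀ Z W → count₂ (W ∩ D) ≤ h (glue Z W)
  count₂-∩-≤-h Z W = ≤-trans (count₂-≤-h (W ∩ D) ∩-⊆ʳ) (H.monotone _ _ ⊆-∪ʳ)

  count₂-∩-≤-g : ∀ Z W → count₂ (W ∩ D) ≤ g (glue Z W)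
  count₂-∩-≤-g Z W = ≤-trans (count₂-≤-g (W ∩ D) ∩-⊆ʳ) (G.monotone _ _ ⊆-∪ʳ)

  count₂-∩-≤-ψ : ∀ Z W → count₂ (W ∩ D) ≤ ψ (glue Z W)
  count₂-∩-≤-ψ Z W = ≤-trans (count₂-∩-≤-h Z W) (m≤n+m _ _)

  cost : SubsetOf P → SubsetOf P → ℕ
  cost Z W = ψ (glue Z W) ∸ count₂ (W ∩ D)

  cost-cong : ∀ Z {W W′} → W ≗ W′ → cost Z W ≡ cost Z W′
  cost-cong Z {W} {W′} W≗W′ =
    cong₂ _∸_ (Ψ.cong-≗ (λ p → cong (λ w → Z p ∨ (w ∧ D p)) (W≗W′ p)))
              (count₂-cong (λ p → cong (_∧ D p) (W≗W′ p)))

  cost-submodular : ∀ Z Z′ W W′ →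
                    cost (Z ∪ Z′) (W ∪ W′) + cost (Z ∩ Z′) (W ∩ W′) ≤ cost Z W + cost Z′ W′
  cost-submodular Z Z′ W W′ = begin
    cost (Z ∪ Z′) (W ∪ W′) + cost (Z ∩ Z′) (W ∩ W′)
      ≡⟨ +-∸-interchange (count₂-∩-≤-ψ (Z ∪ Z′) (W ∪ W′)) (count₂-∩-≤-ψ (Z ∩ Z′) (W ∩ W′)) ⟩
    ψ (glue (Z ∪ Z′) (W ∪ W′)) + ψ (glue (Z ∩ Z′) (W ∩ W′))
      ∸ (count₂ ((W ∪ W′) ∩ D) + count₂ ((W ∩ W′) ∩ D))
      ≤⟨ ∸-mono (Ψ.submodular-⊆ (glue Z W) (glue Z′ W′) (glue-∪ Z Z′ W W′) (glue-∩ Z Z′ W W′))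
                (≤-reflexive (sym (count₂-∩-modular W W′ D))) ⟩
    ψ (glue Z W) + ψ (glue Z′ W′) ∸ (count₂ (W ∩ D) + count₂ (W′ ∩ D))
      ≡⟨ +-∸-interchange (count₂-∩-≤-ψ Z W) (count₂-∩-≤-ψ Z′ W′) ⟨
    cost Z W + cost Z′ W′  ∎
    where open ≤-Reasoning

  minimiser : ∀ Z → Argmin (cost Z)
  minimiser Z = argmin-Subset *↔× (cost Z) (cost-cong Z)

  amalgam : SubsetOf P → ℕ
  amalgam Z = cost Z (proj₁ (minimiser Z))

  amalgam-≤-cost : ∀ Z W → amalgam Z ≤ cost Z W
  amalgam-≤-cost Z = proj₂ (minimiser Z)

  amalgam-isMonotoneSubmodular : IsMonotoneSubmodular amalgam
  amalgam-isMonotoneSubmodular = record { monotone = monotone ; submodular = submodular }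
    where
    monotone : ∀ Z Z′ → Z ⊆ Z′ → amalgam Z ≤ amalgam Z′
    monotone Z Z′ Z⊆Z′ = ≤-trans (amalgam-≤-cost Z W′)
      (∸-monoˡ-≤ (count₂ (W′ ∩ D)) (Ψ.monotone _ _ (glue-mono Z⊆Z′ λ _ t → t)))
      where W′ = proj₁ (minimiser Z′)

    submodular : ∀ Z Z′ → amalgam (Z ∪ Z′) + amalgam (Z ∩ Z′) ≤ amalgam Z + amalgam Z′
    submodular Z Z′ =
      ≤-trans (+-mono-≤ (amalgam-≤-cost (Z ∪ Z′) (W ∪ W′)) (amalgam-≤-cost (Z ∩ Z′) (W ∩ W′)))
              (cost-submodular Z Z′ W W′)
      where
      W  = proj₁ (minimiser Z)
      W′ = proj₁ (minimiser Z′)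

  g-≤-amalgam : ∀ Z → g Z ≤ amalgam Z
  g-≤-amalgam Z = begin
    g Z                 ≤⟨ G.monotone _ _ ⊆-∪ˡ ⟩
    g U                 ≤⟨ m≤m+n (g U) _ ⟩
    g U + (h U ∸ c)     ≡⟨ +-∸-assoc (g U) (count₂-∩-≤-h Z W) ⟨
    amalgam Z           ∎
    where
    open ≤-Reasoning
    W = proj₁ (minimiser Z)
    U = glue Z W
    c = count₂ (W ∩ D)

  h-≤-amalgam : ∀ Z → h Z ≤ amalgam Z
  h-≤-amalgam Z = begin
    h Z                 ≤⟨ H.monotone _ _ ⊆-∪ˡ ⟩
    h U                 ≤⟨ m≤n+m (h U) _ ⟩
    (g U ∸ c) + h U     ≡⟨ +-∸-comm (h U) (count₂-∩-≤-g Z W) ⟨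
    amalgam Z           ∎
    where
    open ≤-Reasoning
    W = proj₁ (minimiser Z)
    U = glue Z W
    c = count₂ (W ∩ D)

  amalgam-≤ : ∀ Z → amalgam Z ≤ g Z + h Z ∸ count₂ (Z ∩ D)
  amalgam-≤ Z = ≤-trans (amalgam-≤-cost Z Z)
    (≤-reflexive (cong (_∸ count₂ (Z ∩ D)) (Ψ.cong-≗ (λ p → ∨-abs-∧ (Z p) (D p)))))

  amalgam≡g : ∀ Z → h Z ≤ count₂ (Z ∩ D) → amalgam Z ≡ g Z
  amalgam≡g Z h≤c = ≤-antisym (begin
    amalgam Z                    ≤⟨ amalgam-≤ Z ⟩
    g Z + h Z ∸ count₂ (Z ∩ D)   ≤⟨ ∸-monoˡ-≤ (count₂ (Z ∩ D)) (+-monoʳ-≤ (g Z) h≤c) ⟩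
    g Z + count₂ (Z ∩ D) ∸ count₂ (Z ∩ D)  ≡⟨ m+n∸n≡m (g Z) (count₂ (Z ∩ D)) ⟩
    g Z                          ∎) (g-≤-amalgam Z)
    where open ≤-Reasoning

  amalgam≡h : ∀ Z → g Z ≤ count₂ (Z ∩ D) → amalgam Z ≡ h Z
  amalgam≡h Z g≤c = ≤-antisym (begin
    amalgam Z                    ≤⟨ amalgam-≤ Z ⟩
    g Z + h Z ∸ count₂ (Z ∩ D)   ≤⟨ ∸-monoˡ-≤ (count₂ (Z ∩ D)) (+-monoˡ-≤ (h Z) g≤c) ⟩
    count₂ (Z ∩ D) + h Z ∸ count₂ (Z ∩ D)  ≡⟨ m+n∸m≡n (count₂ (Z ∩ D)) (h Z) ⟩
    h Z                          ∎) (h-≤-amalgam Z)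
    where open ≤-Reasoning

  amalgam-≤-count₂ : {E₁ E₂ : SubsetOf P} →
                     (∀ X → g X ≤ count₂ (X ∩ E₁)) → (∀ X → h X ≤ count₂ (X ∩ E₂)) → (E₁ ∩ E₂) ⊆ D →
                     ∀ Z → amalgam Z ≤ count₂ Z
  amalgam-≤-count₂ {E₁} {E₂} g≤ h≤ E₁∩E₂⊆D Z = begin
    amalgam Z
      ≤⟨ amalgam-≤ Z ⟩
    g Z + h Z ∸ count₂ (Z ∩ D)
      ≤⟨ ∸-monoˡ-≤ (count₂ (Z ∩ D)) (+-mono-≤ (g≤ Z) (h≤ Z)) ⟩
    count₂ (Z ∩ E₁) + count₂ (Z ∩ E₂) ∸ count₂ (Z ∩ D)
      ≤⟨ m≤n+o⇒m∸n≤o _ (count₂ (Z ∩ D))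
           (count₂-+-≤ (λ p → pointwise (Z p) (E₁ p) (E₂ p) (D p) (E₁∩E₂⊆D p))) ⟩
    count₂ Z  ∎
    where
    open ≤-Reasoning
    pointwise : ∀ z e₁ e₂ d → (T (e₁ ∧ e₂) → T d) → 𝟙 (z ∧ e₁) + 𝟙 (z ∧ e₂) ≤ 𝟙 (z ∧ d) + 𝟙 z
    pointwise false _     _     _     _ = z≤n
    pointwise true  false e₂    d     _ = ≤-trans (𝟙-mono {e₂} {true} (λ _ → tt)) (m≤n+m 1 (𝟙 d))
    pointwise true  true  false d     _ = m≤n+m 1 (𝟙 d)
    pointwise true  true  true  true  _ = ≤-refl
    pointwise true  true  true  false e⇒d = ⊥-elim (e⇒d tt)

module Coupling {n₁ n₂ : ℕ} (M₁ : Matroid n₁) (M₂ : Matroid n₂)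
  {B₁ : SubsetOf (Fin n₁)} {B₂ : SubsetOf (Fin n₂)} (B₁-basis : IsBasis M₁ B₁) (B₂-basis : IsBasis M₂ B₂) where

  rowRank : SubsetOf (Fin n₁ × Fin n₂) → ℕ
  rowRank X = columnRank M₂ B₁ (transpose X)

  rowRank-isMonotoneSubmodular : IsMonotoneSubmodular rowRank
  rowRank-isMonotoneSubmodular = preimage-isMonotoneSubmodular swap (columnRank-isMonotoneSubmodular M₂ B₁)

  rowRank-⊠ : ∀ Y₁ Y₂ → rowRank (Y₁ ⊠ Y₂) ≡ rank M₂ Y₂ * count (Y₁ ∩ B₁)
  rowRank-⊠ Y₁ Y₂ =
    trans (IsMonotoneSubmodular.cong-≗ (columnRank-isMonotoneSubmodular M₂ B₁)
                                       (λ (c , a) → ∧-comm (Y₁ a) (Y₂ c)))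
          (columnRank-⊠ M₂ B₁ Y₂ Y₁)

  count₂-≤-rowRank : ∀ W → W ⊆ (B₁ ⊠ B₂) → count₂ W ≤ rowRank W
  count₂-≤-rowRank W W⊆B₁⊠B₂ = ≤-trans (≤-reflexive (sym (count₂-transpose W)))
    (count₂-≤-columnRank M₂ B₁ B₂-basis (transpose W)
                         (λ (c , a) → subst T (∧-comm (B₁ a) (B₂ c)) ∘ W⊆B₁⊠B₂ (a , c)))

  rowRank-≤-count : ∀ X → rowRank X ≤ count₂ (X ∩ transpose (full ⊠ B₁))
  rowRank-≤-count X = ≤-trans (columnRank-≤-count M₂ B₁ (transpose X))
                              (≤-reflexive (count₂-transpose (X ∩ transpose (full ⊠ B₁))))

  open Amalgam (columnRank-isMonotoneSubmodular M₁ B₂) rowRank-isMonotoneSubmodular (B₁ ⊠ B₂)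
               (count₂-≤-columnRank M₁ B₂ B₁-basis) count₂-≤-rowRank
    public using (amalgam; amalgam-isMonotoneSubmodular; amalgam≡g; amalgam≡h; amalgam-≤-count₂)

  amalgam-isMatroidRank : IsMatroidRank (FinSet n₁ ⊗ FinSet n₂) amalgam
  amalgam-isMatroidRank = record
    { bounded    = λ Z →
        ≤-trans (amalgam-≤-count₂ (columnRank-≤-count M₁ B₂) rowRank-≤-count columns∩rows⊆B₁⊠B₂ Z)
                (≤-reflexive (sym (size≡count₂ Z)))
    ; monotone   = IsMonotoneSubmodular.monotone amalgam-isMonotoneSubmodular
    ; submodular = IsMonotoneSubmodular.submodular amalgam-isMonotoneSubmodular
    }
    where
    columns∩rows⊆B₁⊠B₂ : ((full ⊠ B₂) ∩ transpose (full ⊠ B₁)) ⊆ (B₁ ⊠ B₂)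
    columns∩rows⊆B₁⊠B₂ (a , c) = subst T (∧-comm (B₂ c) (B₁ a))

  amalgam-⊠ : ∀ Y₁ Y₂ → (rank M₁ Y₁ ≡ count (Y₁ ∩ B₁)) ⊎ (rank M₂ Y₂ ≡ count (Y₂ ∩ B₂)) →
              amalgam (Y₁ ⊠ Y₂) ≡ rank M₁ Y₁ * rank M₂ Y₂
  amalgam-⊠ Y₁ Y₂ (inj₁ r₁≡) = begin
    amalgam (Y₁ ⊠ Y₂)              ≡⟨ amalgam≡h (Y₁ ⊠ Y₂) (≤-reflexive (begin
      columnRank M₁ B₂ (Y₁ ⊠ Y₂)              ≡⟨ columnRank-⊠ M₁ B₂ Y₁ Y₂ ⟩
      rank M₁ Y₁ * count (Y₂ ∩ B₂)            ≡⟨ cong (_* count (Y₂ ∩ B₂)) r₁≡ ⟩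
      count (Y₁ ∩ B₁) * count (Y₂ ∩ B₂)       ≡⟨ count₂-⊠-∩ Y₁ B₁ Y₂ B₂ ⟨
      count₂ ((Y₁ ⊠ Y₂) ∩ (B₁ ⊠ B₂))          ∎)) ⟩
    rowRank (Y₁ ⊠ Y₂)              ≡⟨ rowRank-⊠ Y₁ Y₂ ⟩
    rank M₂ Y₂ * count (Y₁ ∩ B₁)   ≡⟨ cong (rank M₂ Y₂ *_) r₁≡ ⟨
    rank M₂ Y₂ * rank M₁ Y₁        ≡⟨ *-comm (rank M₂ Y₂) (rank M₁ Y₁) ⟩
    rank M₁ Y₁ * rank M₂ Y₂        ∎
    where open ≡-Reasoning
  amalgam-⊠ Y₁ Y₂ (inj₂ r₂≡) = begin
    amalgam (Y₁ ⊠ Y₂)              ≡⟨ amalgam≡g (Y₁ ⊠ Y₂) (≤-reflexive (begin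
      rowRank (Y₁ ⊠ Y₂)                       ≡⟨ rowRank-⊠ Y₁ Y₂ ⟩
      rank M₂ Y₂ * count (Y₁ ∩ B₁)            ≡⟨ cong (_* count (Y₁ ∩ B₁)) r₂≡ ⟩
      count (Y₂ ∩ B₂) * count (Y₁ ∩ B₁)       ≡⟨ *-comm (count (Y₂ ∩ B₂)) _ ⟩
      count (Y₁ ∩ B₁) * count (Y₂ ∩ B₂)       ≡⟨ count₂-⊠-∩ Y₁ B₁ Y₂ B₂ ⟨
      count₂ ((Y₁ ⊠ Y₂) ∩ (B₁ ⊠ B₂))          ∎)) ⟩
    columnRank M₁ B₂ (Y₁ ⊠ Y₂)     ≡⟨ columnRank-⊠ M₁ B₂ Y₁ Y₂ ⟩
    rank M₁ Y₁ * count (Y₂ ∩ B₂)   ≡⟨ cong (rank M₁ Y₁ *_) r₂≡ ⟨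
    rank M₁ Y₁ * rank M₂ Y₂        ∎
    where open ≡-Reasoning

corollary3p3 : {n₁ n₂ : ℕ} (M₁ : Matroid n₁) (M₂ : Matroid n₂)
    (B₁ : SubsetOf (Fin n₁)) (B₂ : SubsetOf (Fin n₂)) →
    IsBasis M₁ B₁ → IsBasis M₂ B₂ →
    Σ (SubsetOf (Fin n₁ × Fin n₂) → ℕ) (λ r →
      IsCoupling M₁ M₂ r
      × (∀ (Y₁ : SubsetOf (Fin n₁)) (Y₂ : SubsetOf (Fin n₂)) →
           (Y₁ ⊆ B₁) ⊎ (Y₂ ⊆ B₂) →
           r (Y₁ ⊠ Y₂) ≡ rank M₁ Y₁ * rank M₂ Y₂))
corollary3p3 M₁ M₂ B₁ B₂ B₁-basis B₂-basis =
  amalgam , (amalgam-isMatroidRank , coupling₁ , coupling₂) , rectangle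
  where
  open Coupling M₁ M₂ B₁-basis B₂-basis
  coupling₁ = λ X₁ → amalgam-⊠ X₁ full (inj₂ (rank-full M₂ B₂-basis))
  coupling₂ = λ X₂ → amalgam-⊠ full X₂ (inj₁ (rank-full M₁ B₁-basis))
  rectangle = λ Y₁ Y₂ →
    amalgam-⊠ Y₁ Y₂ ∘ Sum.map (rank-⊆-basis M₁ B₁-basis) (rank-⊆-basis M₂ B₂-basis)
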